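{- Let $\gamma \geq 0$ be an integer and let $\mathrm{S}\subseteq \mathbb{N}$ be a $\gamma$-hyperelliptic numerical semigroup of genus $g \geq 2\gamma+1$. Then the $\mathrm{K}$-weight of $\mathrm{S}$ satisfies \[ \binom{g-2\gamma}{2}+ 2\gamma \;\leq\; W_{\mathrm{K}} \;\leq\; \binom{g-2\gamma}{2}+ 2\gamma^2. \]
   Context: A numerical semigroup $\mathrm{S}\subseteq\mathbb{N}$ is a submonoid of $(\mathbb{N},+)$ with finite complement; its genus is $g=|\mathbb{N}\setminus \mathrm{S}|$. Write the gaps as $\mathbb{N}\setminus\mathrm{S}=\{\ell_1,\dots,\ell_g\}$ with $\ell_1<\cdots<\ell_g$. The $\mathrm{K}$-weight of $\mathrm{S}$ is $W_{\mathrm{K}}:=\sum_{i=1}^{g-1}(\ell_i-i)+g-1$. For an integer $\gamma\ge 0$, $\mathrm{S}$ is called $\gamma$-hyperelliptic if (1) $\mathrm{S}$ contains exactly $\gamma$ even elements in the interval $[2,4\gamma]$, and (2) the $(\gamma+1)$-st positive element of $\mathrm{S}$ is $4\gamma+2$. -}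

module Defs where

open import Data.Bool using (Bool; true; false; not; _∧_)
open import Data.Nat using (ℕ; zero; suc; _+_; _*_; _∸_; _≤_)
open import Data.List using (List; []; _∷_; filter; upTo; length; map; take; zipWith; filterᵇ)
open import Relation.Binary.PropositionalEquality using (_≡_)
open import Data.Product using (_×_)
open import Data.Nat.ListAction using (sum)

-- A numerical semigroup, given by a (decidable, Boolean) membership test.
-- `bound` is some number beyond which every natural number lies in S
-- (this witnesses the finiteness of the complement).
record NumericalSemigroup : Set where
  field
    mem    : ℕ → Bool
    mem-0  : mem 0 ≡ true
    mem-+  : ∀ a b → mem a ≡ true → mem b ≡ true → mem (a + b) ≡ true
    bound  : ℕ
    beyond : ∀ n → bound ≤ n → mem n ≡ true

open NumericalSemigroup public

gaps : NumericalSemigroup → List ℕ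
gaps S = filterᵇ (λ n → not (mem S n)) (upTo (bound S))

genus : NumericalSemigroup → ℕ
genus S = length (gaps S)

-- K-weight: W_K = Σ_{i=1}^{g-1} (ℓ_i - i) + g - 1.
-- (ℓ_i ≥ i always, so truncated subtraction is exact.)
KWeight : NumericalSemigroup → ℕ
KWeight S =
  sum (zipWith _∸_ (take (genus S ∸ 1) (gaps S)) (map suc (upTo (genus S ∸ 1))))
  + (genus S ∸ 1)

countPos : NumericalSemigroup → ℕ → ℕ
countPos S m = length (filterᵇ (mem S) (map suc (upTo m)))

countEven : NumericalSemigroup → ℕ → ℕ
countEven S m = length (filterᵇ (mem S) (map (λ k → 2 * suc k) (upTo m)))

-- γ-hyperelliptic:
--  (1) S contains exactly γ even elements in [2, 4γ];
--  (2) the (γ+1)-st positive element of S is 4γ+2, i.e. 4γ+2 ∈ S and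
--      S has exactly γ elements in [1, 4γ+1].
IsHyperelliptic : ℕ → NumericalSemigroup → Set
IsHyperelliptic γ S =
  countEven S (2 * γ) ≡ γ
  × (mem S (4 * γ + 2) ≡ true × countPos S (4 * γ + 1) ≡ γ)

module Submission where

-- Let E = {e | 2e ∈ S}. The two hyperelliptic conditions force S to have no odd element below
-- 4γ+2 and E to be a numerical semigroup of genus γ whose gaps all lie below 2γ+1, so that
-- g = γ + K, where K ≥ 2γ+1 is the number of odd gaps. A gap x with r gaps below it is ℓ_{r+1}
-- and contributes x − r to W_K.
-- Lower bound: x − r ≥ 1, and x − r ≥ r + 1 − 2γ since at most γ of the gaps up to x are even.
-- Upper bound: an even gap 2e contributes e − (gaps of E below e) ≤ 1 + (gaps of E below e),
-- in total at most C(γ+1,2). An odd gap 2i+1 with o odd gaps, y odd elements and e even gaps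
-- below it contributes 1 + o + 2y − e. Subtracting the odd elements below 2i+1 from it, and the
-- least odd element from the odd gaps above it, yields distinct even gaps, so y is at most γ minus
-- the number of odd gaps above 2i+1; and summing γ − e over i counts each even gap 2e′ at most
-- e′ ≤ 2·(gaps of E below e′) + 1 times.

open import Defs
open import Data.Bool using (Bool; true; false; not)
open import Data.Bool.Properties using (not-injective)
open import Data.List using (List; []; _∷_; [_]; _++_; length; map; take; zipWith; filterᵇ; upTo; applyUpTo)
open import Data.List.Properties using (map-upTo; upTo-∷ʳ; filter-++; ++-identityʳ)
open import Data.Nat using (ℕ; zero; suc; _+_; _*_; _∸_; _≤_; _<_; z≤n; s≤s; _<ᵇ_; _<?_; _⊔_)
open import Data.Nat.Combinatorics using (_C_; nC1≡n; nCk+nC[k+1]≡[n+1]C[k+1])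
open import Data.Nat.ListAction using (sum)
open import Data.Nat.Properties
open import Data.Nat.Tactic.RingSolver using (solve-∀)
open import Data.Product using (_×_; _,_; proj₁; proj₂; ∃-syntax)
open import Data.Sum using (_⊎_; inj₁; inj₂)
open import Function using (_∘_)
open import Relation.Binary.PropositionalEquality hiding ([_])
open import Relation.Nullary using (contradiction; yes; no)

⟦_⟧ : Bool → ℕ
⟦ true ⟧ = 1
⟦ false ⟧ = 0

⟦⟧≤1 : ∀ b → ⟦ b ⟧ ≤ 1
⟦⟧≤1 true = s≤s z≤n
⟦⟧≤1 false = z≤n

⟦⟧+⟦not⟧≡1 : ∀ b → ⟦ b ⟧ + ⟦ not b ⟧ ≡ 1
⟦⟧+⟦not⟧≡1 true = refl
⟦⟧+⟦not⟧≡1 false = refl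

⟦⟧*m≤m : ∀ b m → ⟦ b ⟧ * m ≤ m
⟦⟧*m≤m true m = ≤-reflexive (+-identityʳ m)
⟦⟧*m≤m false m = z≤n

<ᵇ-true : ∀ {m n} → m < n → (m <ᵇ n) ≡ true
<ᵇ-true {zero} {suc n} _ = refl
<ᵇ-true {suc m} {suc n} (s≤s m<n) = <ᵇ-true m<n

<ᵇ-false : ∀ {m n} → n ≤ m → (m <ᵇ n) ≡ false
<ᵇ-false {m} {zero} _ = refl
<ᵇ-false {suc m} {suc n} (s≤s n≤m) = <ᵇ-false n≤m

<ᵇ-true⇒< : ∀ {m n} → (m <ᵇ n) ≡ true → m < n
<ᵇ-true⇒< {zero} {suc n} _ = s≤s z≤n
<ᵇ-true⇒< {suc m} {suc n} eq = s≤s (<ᵇ-true⇒< eq)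

⟦m<ᵇn⟧+⟦n<ᵇ1+m⟧≡1 : ∀ m n → ⟦ m <ᵇ n ⟧ + ⟦ n <ᵇ suc m ⟧ ≡ 1
⟦m<ᵇn⟧+⟦n<ᵇ1+m⟧≡1 zero    zero    = refl
⟦m<ᵇn⟧+⟦n<ᵇ1+m⟧≡1 zero    (suc n) = refl
⟦m<ᵇn⟧+⟦n<ᵇ1+m⟧≡1 (suc m) zero    = refl
⟦m<ᵇn⟧+⟦n<ᵇ1+m⟧≡1 (suc m) (suc n) = ⟦m<ᵇn⟧+⟦n<ᵇ1+m⟧≡1 m n

m∸n+o≤m+[o∸n] : ∀ {m n} o → n ≤ m → m ∸ n + o ≤ m + (o ∸ n)
m∸n+o≤m+[o∸n] {m} {n} o n≤m = begin
  m ∸ n + o               ≤⟨ +-monoʳ-≤ (m ∸ n) (m≤n+m∸n o n) ⟩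
  m ∸ n + (n + (o ∸ n))   ≡⟨ sym (+-assoc (m ∸ n) n (o ∸ n)) ⟩
  m ∸ n + n + (o ∸ n)     ≡⟨ cong (_+ (o ∸ n)) (m∸n+n≡m n≤m) ⟩
  m + (o ∸ n)             ∎
  where open ≤-Reasoning

first-true : ∀ (p : ℕ → Bool) n →
  (∀ u → u < n → p u ≡ false) ⊎ ∃[ μ ] (μ < n × p μ ≡ true × (∀ u → u < μ → p u ≡ false))
first-true p zero = inj₁ (λ _ ())
first-true p (suc n) with first-true p n
... | inj₂ (μ , μ<n , pμ , before) = inj₂ (μ , m<n⇒m<1+n μ<n , pμ , before)
... | inj₁ none with p n in pn
...   | true  = inj₂ (n , n<1+n n , pn , none)
...   | false = inj₁ none′
  where
  none′ : ∀ u → u < suc n → p u ≡ false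
  none′ u u<1+n with m<1+n⇒m<n∨m≡n u<1+n
  ... | inj₁ u<n  = none u u<n
  ... | inj₂ refl = pn

∑< : ℕ → (ℕ → ℕ) → ℕ
∑< zero f = 0
∑< (suc n) f = ∑< n f + f n

syntax ∑< n (λ i → e) = ∑[ i < n ] e

count : (ℕ → Bool) → ℕ → ℕ
count p n = ∑[ i < n ] ⟦ p i ⟧

module _ {f g : ℕ → ℕ} where

  ∑-cong : ∀ n → (∀ i → i < n → f i ≡ g i) → ∑< n f ≡ ∑< n g
  ∑-cong zero _ = refl
  ∑-cong (suc n) eq = cong₂ _+_ (∑-cong n (λ i i<n → eq i (m<n⇒m<1+n i<n))) (eq n (n<1+n n))

  ∑-mono-≤ : ∀ n → (∀ i → i < n → f i ≤ g i) → ∑< n f ≤ ∑< n g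
  ∑-mono-≤ zero _ = z≤n
  ∑-mono-≤ (suc n) le = +-mono-≤ (∑-mono-≤ n (λ i i<n → le i (m<n⇒m<1+n i<n))) (le n (n<1+n n))

  ∑-distrib-+ : ∀ n → ∑[ i < n ] (f i + g i) ≡ ∑< n f + ∑< n g
  ∑-distrib-+ zero = refl
  ∑-distrib-+ (suc n) rewrite ∑-distrib-+ n = +-exchange (∑< n f) (∑< n g) (f n) (g n)
    where
    +-exchange : ∀ a b c d → a + b + (c + d) ≡ a + c + (b + d)
    +-exchange = solve-∀

∑-*-distribˡ-+ : ∀ n (a f g : ℕ → ℕ) →
  ∑[ i < n ] (a i * (f i + g i)) ≡ ∑[ i < n ] (a i * f i) + ∑[ i < n ] (a i * g i)
∑-*-distribˡ-+ n a f g = trans (∑-cong n (λ i _ → *-distribˡ-+ (a i) (f i) (g i))) (∑-distrib-+ n)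

∑-const : ∀ n c → ∑[ _ < n ] c ≡ n * c
∑-const zero c = refl
∑-const (suc n) c rewrite ∑-const n c = +-comm (n * c) c

∑-zero : ∀ n (f : ℕ → ℕ) → (∀ i → i < n → f i ≡ 0) → ∑< n f ≡ 0
∑-zero n f eq = trans (∑-cong n eq) (trans (∑-const n 0) (*-zeroʳ n))

∑-split : ∀ m n (f : ℕ → ℕ) → ∑< (m + n) f ≡ ∑< m f + ∑[ i < n ] f (m + i)
∑-split m zero f rewrite +-identityʳ m = sym (+-identityʳ _)
∑-split m (suc n) f rewrite +-suc m n | ∑-split m n f = +-assoc (∑< m f) _ _

∑-head : ∀ n (f : ℕ → ℕ) → ∑< (suc n) f ≡ f 0 + ∑[ i < n ] f (suc i)
∑-head n f = ∑-split 1 n f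

∑-mono-range : ∀ (f : ℕ → ℕ) {m n} → m ≤ n → ∑< m f ≤ ∑< n f
∑-mono-range f {m} {n} m≤n = begin
  ∑< m f                             ≤⟨ m≤m+n _ _ ⟩
  ∑< m f + ∑[ i < n ∸ m ] f (m + i)  ≡⟨ sym (∑-split m (n ∸ m) f) ⟩
  ∑< (m + (n ∸ m)) f                 ≡⟨ cong (λ k → ∑< k f) (m+[n∸m]≡n m≤n) ⟩
  ∑< n f                             ∎
  where open ≤-Reasoning

∑-vanishing-tail : ∀ (f : ℕ → ℕ) {m n} → m ≤ n → (∀ i → m ≤ i → f i ≡ 0) → ∑< n f ≡ ∑< m f
∑-vanishing-tail f {m} {n} m≤n vanish = begin
  ∑< n f                             ≡⟨ cong (λ k → ∑< k f) (sym (m+[n∸m]≡n m≤n)) ⟩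
  ∑< (m + (n ∸ m)) f                 ≡⟨ ∑-split m (n ∸ m) f ⟩
  ∑< m f + ∑[ i < n ∸ m ] f (m + i)  ≡⟨ cong (∑< m f +_) (∑-zero (n ∸ m) _ (λ i _ → vanish (m + i) (m≤m+n m i))) ⟩
  ∑< m f + 0                         ≡⟨ +-identityʳ _ ⟩
  ∑< m f                             ∎
  where open ≡-Reasoning

∑-reverse : ∀ n (f : ℕ → ℕ) → ∑< n f ≡ ∑[ i < n ] f (n ∸ suc i)
∑-reverse zero f = refl
∑-reverse (suc n) f = begin
  ∑< n f + f n                       ≡⟨ +-comm (∑< n f) (f n) ⟩
  f n + ∑< n f                       ≡⟨ cong (f n +_) (∑-reverse n f) ⟩
  f n + ∑[ i < n ] f (n ∸ suc i)     ≡⟨ sym (∑-head n (λ i → f (n ∸ i))) ⟩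
  ∑[ i < suc n ] f (n ∸ i)           ∎
  where open ≡-Reasoning

∑-*ˡ : ∀ n c (f : ℕ → ℕ) → ∑[ i < n ] (c * f i) ≡ c * ∑< n f
∑-*ˡ zero c f = sym (*-zeroʳ c)
∑-*ˡ (suc n) c f rewrite ∑-*ˡ n c f = sym (*-distribˡ-+ c (∑< n f) (f n))

∑-comm : ∀ m n (f : ℕ → ℕ → ℕ) → ∑[ i < m ] ∑[ j < n ] f i j ≡ ∑[ j < n ] ∑[ i < m ] f i j
∑-comm zero n f = sym (∑-zero n _ (λ _ _ → refl))
∑-comm (suc m) n f rewrite ∑-comm m n f = sym (∑-distrib-+ n)

∑-even-odd : ∀ n (f : ℕ → ℕ) → ∑< (2 * n) f ≡ ∑[ i < n ] f (2 * i) + ∑[ i < n ] f (suc (2 * i))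
∑-even-odd zero f = refl
∑-even-odd (suc n) f = begin
  ∑< (2 * suc n) f                     ≡⟨ cong (λ k → ∑< k f) (*-suc 2 n) ⟩
  ∑< (2 * n) f + f (2 * n) + f (suc (2 * n))
    ≡⟨ cong (λ s → s + f (2 * n) + f (suc (2 * n))) (∑-even-odd n f) ⟩
  ∑[ i < n ] f (2 * i) + ∑[ i < n ] f (suc (2 * i)) + f (2 * n) + f (suc (2 * n))
    ≡⟨ exchange (∑[ i < n ] f (2 * i)) (∑[ i < n ] f (suc (2 * i))) (f (2 * n)) (f (suc (2 * n))) ⟩
  ∑[ i < suc n ] f (2 * i) + ∑[ i < suc n ] f (suc (2 * i)) ∎
  where
  open ≡-Reasoning
  exchange : ∀ a b c d → a + b + c + d ≡ a + c + (b + d)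
  exchange = solve-∀

∑-below : ∀ (a : ℕ → ℕ) {m n} → m ≤ n → ∑[ j < n ] (⟦ j <ᵇ m ⟧ * a j) ≡ ∑< m a
∑-below a {m} {n} m≤n = begin
  ∑[ j < n ] (⟦ j <ᵇ m ⟧ * a j)
    ≡⟨ ∑-vanishing-tail _ m≤n (λ j m≤j → cong (λ b → ⟦ b ⟧ * a j) (<ᵇ-false m≤j)) ⟩
  ∑[ j < m ] (⟦ j <ᵇ m ⟧ * a j)
    ≡⟨ ∑-cong m (λ j j<m → trans (cong (λ b → ⟦ b ⟧ * a j) (<ᵇ-true j<m)) (+-identityʳ (a j))) ⟩
  ∑< m a ∎
  where open ≡-Reasoning

module _ (p : ℕ → Bool) where

  count≤ : ∀ n → count p n ≤ n
  count≤ n = begin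
    count p n        ≤⟨ ∑-mono-≤ n (λ i _ → ⟦⟧≤1 (p i)) ⟩
    ∑[ _ < n ] 1     ≡⟨ ∑-const n 1 ⟩
    n * 1            ≡⟨ *-identityʳ n ⟩
    n                ∎
    where open ≤-Reasoning

  count+count-not : ∀ n → count p n + count (λ i → not (p i)) n ≡ n
  count+count-not n = begin
    count p n + count (λ i → not (p i)) n  ≡⟨ sym (∑-distrib-+ n) ⟩
    ∑[ i < n ] (⟦ p i ⟧ + ⟦ not (p i) ⟧)   ≡⟨ ∑-cong n (λ i _ → ⟦⟧+⟦not⟧≡1 (p i)) ⟩
    ∑[ _ < n ] 1                           ≡⟨ ∑-const n 1 ⟩
    n * 1                                  ≡⟨ *-identityʳ n ⟩
    n                                      ∎
    where open ≡-Reasoning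

  count-mono : ∀ {m n} → m ≤ n → count p m ≤ count p n
  count-mono = ∑-mono-range (λ i → ⟦ p i ⟧)

  count≡0⇒false : ∀ n → count p n ≡ 0 → ∀ i → i < n → p i ≡ false
  count≡0⇒false (suc n) eq i i<1+n with p n in pn | m<1+n⇒m<n∨m≡n i<1+n
  ... | true  | _ = contradiction (trans (sym (+-comm (count p n) 1)) eq) 1+n≢0
  ... | false | inj₁ i<n = count≡0⇒false n (trans (sym (+-identityʳ _)) eq) i i<n
  ... | false | inj₂ refl = pn

  ∑-rank : ∀ n (H : ℕ → ℕ) → ∑[ x < n ] (⟦ p x ⟧ * H (count p x)) ≡ ∑< (count p n) H
  ∑-rank zero H = refl
  ∑-rank (suc n) H with p n
  ... | true  rewrite ∑-rank n H | +-identityʳ (H (count p n)) | +-comm (count p n) 1 = refl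
  ... | false rewrite ∑-rank n H | +-identityʳ (count p n) = +-identityʳ _

  ∑-rank-≤ : ∀ n (h H : ℕ → ℕ) → (∀ x → x < n → p x ≡ true → h x ≤ H (count p x))
           → ∑[ x < n ] (⟦ p x ⟧ * h x) ≤ ∑< (count p n) H
  ∑-rank-≤ n h H le = ≤-trans (∑-mono-≤ n pointwise) (≤-reflexive (∑-rank n H))
    where
    pointwise : ∀ x → x < n → ⟦ p x ⟧ * h x ≤ ⟦ p x ⟧ * H (count p x)
    pointwise x x<n with p x in px
    ... | true  = +-monoˡ-≤ 0 (le x x<n px)
    ... | false = z≤n

  ∑-rank-≥ : ∀ n (h H : ℕ → ℕ) → (∀ x → x < n → p x ≡ true → H (count p x) ≤ h x)
           → ∑< (count p n) H ≤ ∑[ x < n ] (⟦ p x ⟧ * h x)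
  ∑-rank-≥ n h H le = ≤-trans (≤-reflexive (sym (∑-rank n H))) (∑-mono-≤ n pointwise)
    where
    pointwise : ∀ x → x < n → ⟦ p x ⟧ * H (count p x) ≤ ⟦ p x ⟧ * h x
    pointwise x x<n with p x in px
    ... | true  = +-monoˡ-≤ 0 (le x x<n px)
    ... | false = z≤n

∑-suc≡C2 : ∀ n → ∑[ i < n ] suc i ≡ suc n C 2
∑-suc≡C2 zero = refl
∑-suc≡C2 (suc n) = begin
  ∑[ i < n ] suc i + suc n   ≡⟨ cong (_+ suc n) (∑-suc≡C2 n) ⟩
  suc n C 2 + suc n          ≡⟨ +-comm (suc n C 2) (suc n) ⟩
  suc n + suc n C 2          ≡⟨ cong (_+ suc n C 2) (sym (nC1≡n (suc n))) ⟩
  suc n C 1 + suc n C 2      ≡⟨ nCk+nC[k+1]≡[n+1]C[k+1] (suc n) 1 ⟩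
  suc (suc n) C 2            ∎
  where open ≡-Reasoning

∑-id≡C2 : ∀ n → ∑[ i < n ] i ≡ n C 2
∑-id≡C2 zero = refl
∑-id≡C2 (suc n) = trans (∑-head n (λ i → i)) (∑-suc≡C2 n)

∑-odd≡square : ∀ n → ∑[ i < n ] (2 * i + 1) ≡ n * n
∑-odd≡square zero = refl
∑-odd≡square (suc n) = trans (cong (_+ (2 * n + 1)) (∑-odd≡square n)) (square-suc n)
  where
  square-suc : ∀ n → n * n + (2 * n + 1) ≡ suc n * suc n
  square-suc = solve-∀

2*[1+n]C2≡n*[1+n] : ∀ n → 2 * (suc n C 2) ≡ n * suc n
2*[1+n]C2≡n*[1+n] zero = refl
2*[1+n]C2≡n*[1+n] (suc n) = begin
  2 * (suc (suc n) C 2)          ≡⟨ cong (2 *_) (sym (∑-suc≡C2 (suc n))) ⟩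
  2 * (∑[ i < n ] suc i + suc n) ≡⟨ *-distribˡ-+ 2 (∑[ i < n ] suc i) (suc n) ⟩
  2 * ∑[ i < n ] suc i + 2 * suc n ≡⟨ cong (λ s → 2 * s + 2 * suc n) (∑-suc≡C2 n) ⟩
  2 * (suc n C 2) + 2 * suc n    ≡⟨ cong (_+ 2 * suc n) (2*[1+n]C2≡n*[1+n] n) ⟩
  n * suc n + 2 * suc n          ≡⟨ step n ⟩
  suc n * suc (suc n)            ∎
  where
  open ≡-Reasoning
  step : ∀ n → n * suc n + 2 * suc n ≡ suc n * suc (suc n)
  step = solve-∀

2*nC2+n≡n*n : ∀ n → 2 * (n C 2) + n ≡ n * n
2*nC2+n≡n*n zero = refl
2*nC2+n≡n*n (suc n) = trans (cong (_+ suc n) (2*[1+n]C2≡n*[1+n] n)) (step n)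
  where
  step : ∀ n → n * suc n + suc n ≡ suc n * suc n
  step = solve-∀

count-<ᵇ≤ : ∀ n e → count (_<ᵇ e) n ≤ e
count-<ᵇ≤ n e = begin
  count (_<ᵇ e) n                       ≤⟨ ∑-mono-range _ (m≤m+n n e) ⟩
  count (_<ᵇ e) (n + e)                 ≡⟨ ∑-cong (n + e) (λ i _ → sym (*-identityʳ _)) ⟩
  ∑[ i < n + e ] (⟦ i <ᵇ e ⟧ * 1)       ≡⟨ ∑-below (λ _ → 1) (m≤n+m e n) ⟩
  ∑[ _ < e ] 1                          ≡⟨ ∑-const e 1 ⟩
  e * 1                                 ≡⟨ *-identityʳ e ⟩
  e                                     ∎
  where open ≤-Reasoning

∑-γ∸[m∸i]≤γC2 : ∀ γ m → ∑[ i < m ] (γ ∸ (m ∸ i)) ≤ γ C 2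
∑-γ∸[m∸i]≤γC2 γ m = begin
  ∑[ i < m ] (γ ∸ (m ∸ i))                ≡⟨ ∑-reverse m _ ⟩
  ∑[ i < m ] (γ ∸ (m ∸ (m ∸ suc i)))      ≡⟨ ∑-cong m (λ i i<m → cong (γ ∸_) (m∸[m∸n]≡n i<m)) ⟩
  ∑[ i < m ] (γ ∸ suc i)                  ≤⟨ ∑-mono-range _ (m≤n+m m γ) ⟩
  ∑[ i < γ + m ] (γ ∸ suc i)              ≡⟨ ∑-vanishing-tail _ (m≤m+n γ m) (λ i → m≤n⇒m∸n≡0 ∘ m≤n⇒m≤1+n) ⟩
  ∑[ i < γ ] (γ ∸ suc i)                  ≡⟨ ∑-reverse γ _ ⟩
  ∑[ i < γ ] (γ ∸ suc (γ ∸ suc i))        ≡⟨ ∑-cong γ (λ i i<γ → cong (γ ∸_) (sym (+-∸-assoc 1 i<γ))) ⟩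
  ∑[ i < γ ] (γ ∸ (γ ∸ i))                ≡⟨ ∑-cong γ (λ i i<γ → m∸[m∸n]≡n (<⇒≤ i<γ)) ⟩
  ∑[ i < γ ] i                            ≡⟨ ∑-id≡C2 γ ⟩
  γ C 2                                   ∎
  where open ≤-Reasoning

∑-1⊔[1+j∸a] : ∀ a t → ∑[ j < a + t ] (1 ⊔ (suc j ∸ a)) ≡ a + suc t C 2
∑-1⊔[1+j∸a] a t = begin
  ∑[ j < a + t ] (1 ⊔ (suc j ∸ a))                                ≡⟨ ∑-split a t _ ⟩
  ∑[ j < a ] (1 ⊔ (suc j ∸ a)) + ∑[ i < t ] (1 ⊔ (suc (a + i) ∸ a))
    ≡⟨ cong₂ _+_ (∑-cong a (λ j j<a → cong (1 ⊔_) (m≤n⇒m∸n≡0 j<a)))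
                 (∑-cong t (λ i _ → cong (1 ⊔_) (trans (cong (_∸ a) (sym (+-suc a i))) (m+n∸m≡n a (suc i))))) ⟩
  ∑[ _ < a ] 1 + ∑[ i < t ] suc i
    ≡⟨ cong₂ _+_ (trans (∑-const a 1) (*-identityʳ a)) (∑-suc≡C2 t) ⟩
  a + suc t C 2 ∎
  where open ≡-Reasoning

-- The arithmetic closing the upper bound, for K = 2γ+t+1 odd gaps; doubling and adding 2γ
-- clears both the halving in C(n,2) and the subtraction in 2·C(γ,2) = γ² − γ.
C2-identity : ∀ γ t → suc γ C 2 + (suc (2 * γ + t) C 2 + 2 * (γ C 2) + γ * γ)
                       ≡ suc (γ + t) C 2 + 2 * γ * γ + (2 * γ + t) * γ
C2-identity γ t = *-cancelˡ-≡ _ _ 2 (+-cancelʳ-≡ (2 * γ) _ _ (begin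
  2 * (a + (b + 2 * c + γ * γ)) + 2 * γ           ≡⟨ expand a b c γ ⟩
  2 * a + 2 * b + 2 * (2 * c + γ) + 2 * (γ * γ)
    ≡⟨ cong₂ (λ x y → x + y + 2 * (2 * c + γ) + 2 * (γ * γ)) (2*[1+n]C2≡n*[1+n] γ) (2*[1+n]C2≡n*[1+n] m) ⟩
  γ * suc γ + m * suc m + 2 * (2 * c + γ) + 2 * (γ * γ)
    ≡⟨ cong (λ x → γ * suc γ + m * suc m + 2 * x + 2 * (γ * γ)) (2*nC2+n≡n*n γ) ⟩
  γ * suc γ + m * suc m + 2 * (γ * γ) + 2 * (γ * γ) ≡⟨ polynomial γ t ⟩
  (γ + t) * suc (γ + t) + 2 * (2 * γ * γ + m * γ) + 2 * γ
    ≡⟨ cong (λ x → x + 2 * (2 * γ * γ + m * γ) + 2 * γ) (sym (2*[1+n]C2≡n*[1+n] (γ + t))) ⟩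
  2 * d + 2 * (2 * γ * γ + m * γ) + 2 * γ         ≡⟨ collect d γ m ⟩
  2 * (d + 2 * γ * γ + m * γ) + 2 * γ             ∎))
  where
  open ≡-Reasoning
  m = 2 * γ + t
  a = suc γ C 2
  b = suc m C 2
  c = γ C 2
  d = suc (γ + t) C 2
  expand : ∀ a b c γ → 2 * (a + (b + 2 * c + γ * γ)) + 2 * γ ≡ 2 * a + 2 * b + 2 * (2 * c + γ) + 2 * (γ * γ)
  expand = solve-∀
  polynomial : ∀ γ t → γ * suc γ + (2 * γ + t) * suc (2 * γ + t) + 2 * (γ * γ) + 2 * (γ * γ)
                       ≡ (γ + t) * suc (γ + t) + 2 * (2 * γ * γ + (2 * γ + t) * γ) + 2 * γ
  polynomial = solve-∀
  collect : ∀ d γ m → 2 * d + 2 * (2 * γ * γ + m * γ) + 2 * γ ≡ 2 * (d + 2 * γ * γ + m * γ) + 2 * γ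
  collect = solve-∀

length-filterᵇ-applyUpTo : ∀ (p : ℕ → Bool) (h : ℕ → ℕ) n →
  length (filterᵇ p (applyUpTo h n)) ≡ ∑[ i < n ] ⟦ p (h i) ⟧
length-filterᵇ-applyUpTo p h zero = refl
length-filterᵇ-applyUpTo p h (suc n) = begin
  length (filterᵇ p (applyUpTo h (suc n)))         ≡⟨ head-case (p (h 0)) refl ⟩
  ⟦ p (h 0) ⟧ + length (filterᵇ p (applyUpTo (λ i → h (suc i)) n))
    ≡⟨ cong (⟦ p (h 0) ⟧ +_) (length-filterᵇ-applyUpTo p (λ i → h (suc i)) n) ⟩
  ⟦ p (h 0) ⟧ + ∑[ i < n ] ⟦ p (h (suc i)) ⟧       ≡⟨ sym (∑-head n (λ i → ⟦ p (h i) ⟧)) ⟩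
  ∑[ i < suc n ] ⟦ p (h i) ⟧                       ∎
  where
  open ≡-Reasoning
  rest = filterᵇ p (applyUpTo (λ i → h (suc i)) n)
  head-case : ∀ b → p (h 0) ≡ b → length (filterᵇ p (applyUpTo h (suc n))) ≡ ⟦ b ⟧ + length rest
  head-case true  eq rewrite eq = refl
  head-case false eq rewrite eq = refl

-- Junk value 0 past the end; it is only ever applied below the length.
nth : List ℕ → ℕ → ℕ
nth []       _       = 0
nth (x ∷ xs) zero    = x
nth (x ∷ xs) (suc i) = nth xs i

nth-++ˡ : ∀ xs ys {i} → i < length xs → nth (xs ++ ys) i ≡ nth xs i
nth-++ˡ (x ∷ xs) ys {zero}  _         = refl
nth-++ˡ (x ∷ xs) ys {suc i} (s≤s i<n) = nth-++ˡ xs ys i<n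

nth-++-length : ∀ xs y ys → nth (xs ++ y ∷ ys) (length xs) ≡ y
nth-++-length []       y ys = refl
nth-++-length (x ∷ xs) y ys = nth-++-length xs y ys

sum-zipWith-take : ∀ (_⊕_ : ℕ → ℕ → ℕ) (h : ℕ → ℕ) xs n → n ≤ length xs →
  sum (zipWith _⊕_ (take n xs) (applyUpTo h n)) ≡ ∑[ i < n ] (nth xs i ⊕ h i)
sum-zipWith-take _⊕_ h xs       zero    _ = refl
sum-zipWith-take _⊕_ h (x ∷ xs) (suc n) (s≤s n≤len) = begin
  (x ⊕ h 0) + sum (zipWith _⊕_ (take n xs) (applyUpTo (λ i → h (suc i)) n))
    ≡⟨ cong ((x ⊕ h 0) +_) (sum-zipWith-take _⊕_ (λ i → h (suc i)) xs n n≤len) ⟩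
  (x ⊕ h 0) + ∑[ i < n ] (nth xs i ⊕ h (suc i))
    ≡⟨ sym (∑-head n (λ i → nth (x ∷ xs) i ⊕ h i)) ⟩
  ∑[ i < suc n ] (nth (x ∷ xs) i ⊕ h i) ∎
  where open ≡-Reasoning

module _ (p : ℕ → Bool) where

  ∑-nth-filterᵇ : ∀ n (G : ℕ → ℕ → ℕ) →
    ∑[ j < count p n ] G j (nth (filterᵇ p (upTo n)) j) ≡ ∑[ x < n ] (⟦ p x ⟧ * G (count p x) x)
  ∑-nth-filterᵇ zero G = refl
  ∑-nth-filterᵇ (suc n) G = last-case (p n) refl
    where
    open ≡-Reasoning
    xs = filterᵇ p (upTo n)
    length-xs : length xs ≡ count p n
    length-xs = length-filterᵇ-applyUpTo p (λ x → x) n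
    snoc : filterᵇ p (upTo (suc n)) ≡ xs ++ filterᵇ p [ n ]
    snoc = trans (cong (filterᵇ p) (sym (upTo-∷ʳ n))) (filter-++ _ (upTo n) [ n ])
    last-case : ∀ b → p n ≡ b →
      ∑[ j < count p (suc n) ] G j (nth (filterᵇ p (upTo (suc n))) j)
        ≡ ∑[ x < n ] (⟦ p x ⟧ * G (count p x) x) + ⟦ p n ⟧ * G (count p n) n
    last-case false pn rewrite snoc | pn | ++-identityʳ xs | +-identityʳ (count p n) =
      trans (∑-nth-filterᵇ n G) (sym (+-identityʳ _))
    last-case true pn rewrite snoc | pn | +-comm (count p n) 1 | +-identityʳ (G (count p n) n) = begin
      ∑[ j < count p n ] G j (nth (xs ++ [ n ]) j) + G (count p n) (nth (xs ++ [ n ]) (count p n))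
        ≡⟨ cong₂ _+_ (∑-cong (count p n) (λ j j<c → cong (G j) (nth-++ˡ xs [ n ] (subst (j <_) (sym length-xs) j<c))))
                     (cong (G (count p n)) (subst (λ k → nth (xs ++ [ n ]) k ≡ n) length-xs (nth-++-length xs n []))) ⟩
      ∑[ j < count p n ] G j (nth xs j) + G (count p n) n
        ≡⟨ cong (_+ G (count p n) n) (∑-nth-filterᵇ n G) ⟩
      ∑[ x < n ] (⟦ p x ⟧ * G (count p x) x) + G (count p n) n ∎

module Submonoid (P : ℕ → Bool) (P-0 : P 0 ≡ true)
                 (P-+ : ∀ a b → P a ≡ true → P b ≡ true → P (a + b) ≡ true) where

  gapsBelow : ℕ → ℕ
  gapsBelow = count (λ x → not (P x))

  positiveElementsUpTo : ℕ → ℕ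
  positiveElementsUpTo m = count (λ k → P (suc k)) m

  gapsBelow[1+m]+positiveElementsUpTo≡m : ∀ m → gapsBelow (suc m) + positiveElementsUpTo m ≡ m
  gapsBelow[1+m]+positiveElementsUpTo≡m m = begin
    gapsBelow (suc m) + positiveElementsUpTo m
      ≡⟨ cong (_+ positiveElementsUpTo m) (∑-head m (λ x → ⟦ not (P x) ⟧)) ⟩
    ⟦ not (P 0) ⟧ + count (λ k → not (P (suc k))) m + positiveElementsUpTo m
      ≡⟨ cong (λ b → ⟦ not b ⟧ + count (λ k → not (P (suc k))) m + positiveElementsUpTo m) P-0 ⟩
    count (λ k → not (P (suc k))) m + positiveElementsUpTo m
      ≡⟨ +-comm _ (positiveElementsUpTo m) ⟩
    positiveElementsUpTo m + count (λ k → not (P (suc k))) m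
      ≡⟨ count+count-not (λ k → P (suc k)) m ⟩
    m ∎
    where open ≡-Reasoning

  gapsBelow<gap : ∀ {x} → P x ≡ false → gapsBelow x < x
  gapsBelow<gap {zero}  Px = contradiction (trans (sym P-0) Px) λ ()
  gapsBelow<gap {suc m} _  = s≤s (begin
    gapsBelow (suc m)                           ≤⟨ m≤m+n _ _ ⟩
    gapsBelow (suc m) + positiveElementsUpTo m  ≡⟨ gapsBelow[1+m]+positiveElementsUpTo≡m m ⟩
    m                                           ∎)
    where open ≤-Reasoning

  -- Pair k+1 with m−k: the two sum to the gap m+1, so at most one of them lies in P.
  2*positiveElementsUpTo≤ : ∀ m → P (suc m) ≡ false → 2 * positiveElementsUpTo m ≤ m
  2*positiveElementsUpTo≤ m Pm = begin
    2 * X                                   ≡⟨ cong (X +_) (+-identityʳ X) ⟩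
    X + X                                   ≡⟨ cong (X +_) (∑-reverse m h) ⟩
    X + ∑[ k < m ] h (m ∸ suc k)            ≡⟨ sym (∑-distrib-+ m) ⟩
    ∑[ k < m ] (h k + h (m ∸ suc k))        ≤⟨ ∑-mono-≤ m at-most-one ⟩
    ∑[ _ < m ] 1                            ≡⟨ trans (∑-const m 1) (*-identityʳ m) ⟩
    m                                       ∎
    where
    open ≤-Reasoning
    h : ℕ → ℕ
    h k = ⟦ P (suc k) ⟧
    X = positiveElementsUpTo m
    at-most-one : ∀ k → k < m → h k + h (m ∸ suc k) ≤ 1
    at-most-one k k<m with P (suc k) in Pk | P (suc (m ∸ suc k)) in Pk′
    ... | false | b     = ⟦⟧≤1 b
    ... | true  | false = ≤-refl
    ... | true  | true  = contradiction (trans (sym Pm) (subst (λ z → P z ≡ true) sum≡ (P-+ _ _ Pk Pk′))) λ ()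
      where
      sum≡ : suc k + suc (m ∸ suc k) ≡ suc m
      sum≡ = trans (+-suc (suc k) (m ∸ suc k)) (cong suc (m+[n∸m]≡n k<m))

  gap≤2*gapsBelow+1 : ∀ {e} → P e ≡ false → e ≤ 2 * gapsBelow e + 1
  gap≤2*gapsBelow+1 {zero}  Pe = z≤n
  gap≤2*gapsBelow+1 {suc m} Pe = subst (suc m ≤_) (+-comm 1 (2 * Y)) (s≤s m≤2Y)
    where
    X = positiveElementsUpTo m
    Y = gapsBelow (suc m)
    Y+X≡m : Y + X ≡ m
    Y+X≡m = gapsBelow[1+m]+positiveElementsUpTo≡m m
    X≤Y : X ≤ Y
    X≤Y = +-cancelˡ-≤ X X Y (begin
      X + X       ≡⟨ cong (X +_) (sym (+-identityʳ X)) ⟩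
      2 * X       ≤⟨ 2*positiveElementsUpTo≤ m Pe ⟩
      m           ≡⟨ trans (sym Y+X≡m) (+-comm Y X) ⟩
      X + Y       ∎)
      where open ≤-Reasoning
    m≤2Y : m ≤ 2 * Y
    m≤2Y = begin
      m           ≡⟨ sym Y+X≡m ⟩
      Y + X       ≤⟨ +-monoʳ-≤ Y X≤Y ⟩
      Y + Y       ≡⟨ cong (Y +_) (sym (+-identityʳ Y)) ⟩
      2 * Y       ∎
      where open ≤-Reasoning

module _ (S : NumericalSemigroup) where
  open Submonoid (mem S) (mem-0 S) (mem-+ S)

  genus≡gapsBelow-bound : genus S ≡ gapsBelow (bound S)
  genus≡gapsBelow-bound = length-filterᵇ-applyUpTo (λ x → not (mem S x)) (λ x → x) (bound S)

  -- The gap x = ℓ_{r+1}, r = gapsBelow x, contributes (ℓ_{r+1} − (r+1)) + 1 = x − r if r < g − 1.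
  KWeight≡∑-gaps : KWeight S ≡
    ∑[ x < bound S ] (⟦ not (mem S x) ⟧ * (⟦ gapsBelow x <ᵇ genus S ∸ 1 ⟧ * (x ∸ gapsBelow x)))
  KWeight≡∑-gaps = begin
    sum (zipWith _∸_ (take n (gaps S)) (map suc (upTo n))) + n
      ≡⟨ cong (λ ys → sum (zipWith _∸_ (take n (gaps S)) ys) + n) (map-upTo suc n) ⟩
    sum (zipWith _∸_ (take n (gaps S)) (applyUpTo suc n)) + n
      ≡⟨ cong₂ _+_ (sum-zipWith-take _∸_ suc (gaps S) n (m∸n≤m g 1)) (sym (trans (∑-const n 1) (*-identityʳ n))) ⟩
    ∑[ i < n ] (nth (gaps S) i ∸ suc i) + ∑[ _ < n ] 1
      ≡⟨ sym (∑-distrib-+ n) ⟩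
    ∑[ i < n ] G′ i
      ≡⟨ sym (∑-below G′ (m∸n≤m g 1)) ⟩
    ∑[ j < g ] (⟦ j <ᵇ n ⟧ * G′ j)
      ≡⟨ cong (λ k → ∑[ j < k ] (⟦ j <ᵇ n ⟧ * G′ j)) genus≡gapsBelow-bound ⟩
    ∑[ j < gapsBelow (bound S) ] G j (nth (gaps S) j)
      ≡⟨ ∑-nth-filterᵇ (λ x → not (mem S x)) (bound S) G ⟩
    ∑[ x < bound S ] (⟦ not (mem S x) ⟧ * G (gapsBelow x) x)
      ≡⟨ ∑-cong (bound S) (λ x _ → at-gap x (mem S x) refl) ⟩
    ∑[ x < bound S ] (⟦ not (mem S x) ⟧ * (⟦ gapsBelow x <ᵇ n ⟧ * (x ∸ gapsBelow x))) ∎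
    where
    open ≡-Reasoning
    g = genus S
    n = g ∸ 1
    G : ℕ → ℕ → ℕ
    G j x = ⟦ j <ᵇ n ⟧ * (x ∸ suc j + 1)
    G′ : ℕ → ℕ
    G′ i = nth (gaps S) i ∸ suc i + 1
    at-gap : ∀ x b → mem S x ≡ b →
      ⟦ not b ⟧ * G (gapsBelow x) x ≡ ⟦ not b ⟧ * (⟦ gapsBelow x <ᵇ n ⟧ * (x ∸ gapsBelow x))
    at-gap x true  _  = refl
    at-gap x false Sx = cong (λ k → 1 * (⟦ gapsBelow x <ᵇ n ⟧ * k))
      (trans (+-comm _ 1) (sym (+-∸-assoc 1 (gapsBelow<gap Sx))))

gap<bound : ∀ S {x} → mem S x ≡ false → x < bound S
gap<bound S {x} Sx with x <? bound S
... | yes x<bound = x<bound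
... | no  x≮bound = contradiction (trans (sym (beyond S x (≮⇒≥ x≮bound))) Sx) λ ()

even-or-odd : ∀ x → ∃[ m ] (x ≡ 2 * m ⊎ x ≡ suc (2 * m))
even-or-odd zero = 0 , inj₁ refl
even-or-odd (suc x) with even-or-odd x
... | m , inj₁ refl = m , inj₂ refl
... | m , inj₂ refl = suc m , inj₁ (sym (2*[1+m]≡2+2*m m))
  where
  2*[1+m]≡2+2*m : ∀ m → 2 * suc m ≡ suc (suc (2 * m))
  2*[1+m]≡2+2*m = solve-∀

module Hyperelliptic (γ : ℕ) (S : NumericalSemigroup) (hyp : IsHyperelliptic γ S) where

  open Submonoid (mem S) (mem-0 S) (mem-+ S) using () renaming (gapsBelow to rank; gapsBelow<gap to rank<gap)

  weight : ℕ → ℕ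
  weight x = x ∸ rank x

  even : ℕ → Bool
  even e = mem S (2 * e)

  odd : ℕ → Bool
  odd u = mem S (suc (2 * u))

  even-+ : ∀ a b → even a ≡ true → even b ≡ true → even (a + b) ≡ true
  even-+ a b ea eb = subst (λ x → mem S x ≡ true) (sym (*-distribˡ-+ 2 a b)) (mem-+ S _ _ ea eb)

  even+odd : ∀ a b → even a ≡ true → odd b ≡ true → odd (a + b) ≡ true
  even+odd a b ea ob = subst (λ x → mem S x ≡ true) (2*a+[1+2*b]≡1+2*[a+b] a b) (mem-+ S _ _ ea ob)
    where
    2*a+[1+2*b]≡1+2*[a+b] : ∀ a b → 2 * a + suc (2 * b) ≡ suc (2 * (a + b))
    2*a+[1+2*b]≡1+2*[a+b] = solve-∀

  module Even = Submonoid even (mem-0 S) even-+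
  open Even using () renaming (gapsBelow to evenGaps)

  oddGaps : ℕ → ℕ
  oddGaps = count (λ u → not (odd u))

  oddElems : ℕ → ℕ
  oddElems = count odd

  rank-2* : ∀ m → rank (2 * m) ≡ evenGaps m + oddGaps m
  rank-2* m = ∑-even-odd m (λ x → ⟦ not (mem S x) ⟧)

  rank-1+2* : ∀ m → rank (suc (2 * m)) ≡ evenGaps (suc m) + oddGaps m
  rank-1+2* m = trans (cong (_+ ⟦ not (even m) ⟧) (rank-2* m)) (+-exchange (evenGaps m) (oddGaps m) _)
    where
    +-exchange : ∀ a b c → a + b + c ≡ a + c + b
    +-exchange = solve-∀

  evenElementsUpTo[2γ]≡γ : Even.positiveElementsUpTo (2 * γ) ≡ γ
  evenElementsUpTo[2γ]≡γ = begin
    Even.positiveElementsUpTo (2 * γ)  ≡⟨ sym (length-filterᵇ-applyUpTo (mem S) (λ k → 2 * suc k) (2 * γ)) ⟩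
    length (filterᵇ (mem S) (applyUpTo (λ k → 2 * suc k) (2 * γ)))
      ≡⟨ cong (λ xs → length (filterᵇ (mem S) xs)) (sym (map-upTo (λ k → 2 * suc k) (2 * γ))) ⟩
    countEven S (2 * γ)          ≡⟨ proj₁ hyp ⟩
    γ                            ∎
    where open ≡-Reasoning

  elementsUpTo[4γ+1]≡γ : count (λ k → mem S (suc k)) (4 * γ + 1) ≡ γ
  elementsUpTo[4γ+1]≡γ = begin
    count (λ k → mem S (suc k)) (4 * γ + 1)  ≡⟨ sym (length-filterᵇ-applyUpTo (mem S) suc (4 * γ + 1)) ⟩
    length (filterᵇ (mem S) (applyUpTo suc (4 * γ + 1)))
      ≡⟨ cong (λ xs → length (filterᵇ (mem S) xs)) (sym (map-upTo suc (4 * γ + 1))) ⟩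
    countPos S (4 * γ + 1)                    ≡⟨ proj₂ (proj₂ hyp) ⟩
    γ                                         ∎
    where open ≡-Reasoning

  even[2γ+1] : even (2 * γ + 1) ≡ true
  even[2γ+1] = subst (λ x → mem S x ≡ true) (4*γ+2≡2*[2*γ+1] γ) (proj₁ (proj₂ hyp))
    where
    4*γ+2≡2*[2*γ+1] : ∀ γ → 4 * γ + 2 ≡ 2 * (2 * γ + 1)
    4*γ+2≡2*[2*γ+1] = solve-∀

  -- The γ elements of S in [1, 4γ+1] are already accounted for by the even ones.
  oddElems[1+2γ]≡0 : oddElems (suc (2 * γ)) ≡ 0
  oddElems[1+2γ]≡0 = +-cancelʳ-≡ γ _ _ (begin
    oddElems (2 * γ) + ⟦ odd (2 * γ) ⟧ + γ
      ≡⟨ +-exchange (oddElems (2 * γ)) _ γ ⟩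
    oddElems (2 * γ) + γ + ⟦ odd (2 * γ) ⟧
      ≡⟨ cong (λ c → oddElems (2 * γ) + c + ⟦ odd (2 * γ) ⟧) (sym evens) ⟩
    oddElems (2 * γ) + count (λ i → mem S (suc (suc (2 * i)))) (2 * γ) + ⟦ odd (2 * γ) ⟧
      ≡⟨ cong (_+ ⟦ odd (2 * γ) ⟧) (sym (∑-even-odd (2 * γ) (λ k → ⟦ mem S (suc k) ⟧))) ⟩
    count (λ k → mem S (suc k)) (suc (2 * (2 * γ)))
      ≡⟨ cong (count (λ k → mem S (suc k))) (1+2*[2*γ]≡4*γ+1 γ) ⟩
    count (λ k → mem S (suc k)) (4 * γ + 1)
      ≡⟨ elementsUpTo[4γ+1]≡γ ⟩
    0 + γ ∎)
    where
    open ≡-Reasoning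
    +-exchange : ∀ a b c → a + b + c ≡ a + c + b
    +-exchange = solve-∀
    1+2*[2*γ]≡4*γ+1 : ∀ γ → suc (2 * (2 * γ)) ≡ 4 * γ + 1
    1+2*[2*γ]≡4*γ+1 = solve-∀
    2+2*i≡2*[1+i] : ∀ i → suc (suc (2 * i)) ≡ 2 * suc i
    2+2*i≡2*[1+i] = solve-∀
    evens : count (λ i → mem S (suc (suc (2 * i)))) (2 * γ) ≡ γ
    evens = trans (∑-cong (2 * γ) (λ i _ → cong (λ x → ⟦ mem S x ⟧) (2+2*i≡2*[1+i] i))) evenElementsUpTo[2γ]≡γ

  odd-small : ∀ {u} → u ≤ 2 * γ → odd u ≡ false
  odd-small u≤2γ = count≡0⇒false odd (suc (2 * γ)) oddElems[1+2γ]≡0 _ (s≤s u≤2γ)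

  -- If 2γ+1+j were the least gap of E beyond 2γ, then E would contain γ + j of 1, …, 2γ+j.
  evens-from-2γ+1 : ∀ j k → k < j → even (2 * γ + 1 + k) ≡ true
  evens-from-2γ+1 (suc j) k k<1+j with m<1+n⇒m<n∨m≡n k<1+j
  ... | inj₁ k<j  = evens-from-2γ+1 j k k<j
  ... | inj₂ refl = newest j (evens-from-2γ+1 j)
    where
    newest : ∀ j → (∀ k → k < j → even (2 * γ + 1 + k) ≡ true) → even (2 * γ + 1 + j) ≡ true
    newest zero    _       = subst (λ x → even x ≡ true) (sym (+-identityʳ (2 * γ + 1))) even[2γ+1]
    newest (suc i) earlier with even (2 * γ + 1 + suc i) in gap?
    ... | true  = refl
    ... | false = contradiction too-many 1+n≰n
      where
      m = 2 * γ + 1 + i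
      1+m≡ : suc m ≡ 2 * γ + 1 + suc i
      1+m≡ = sym (+-suc (2 * γ + 1) i)
      count≡ : Even.positiveElementsUpTo m ≡ γ + suc i
      count≡ = begin
        Even.positiveElementsUpTo m
          ≡⟨ cong Even.positiveElementsUpTo (+-assoc (2 * γ) 1 i) ⟩
        Even.positiveElementsUpTo (2 * γ + suc i)
          ≡⟨ ∑-split (2 * γ) (suc i) _ ⟩
        Even.positiveElementsUpTo (2 * γ) + ∑[ k < suc i ] ⟦ even (suc (2 * γ + k)) ⟧
          ≡⟨ cong₂ _+_ evenElementsUpTo[2γ]≡γ (∑-cong (suc i) (λ k k<1+i → cong ⟦_⟧
               (subst (λ x → even x ≡ true) (trans (+-assoc (2 * γ) 1 k) (+-suc (2 * γ) k)) (earlier k k<1+i)))) ⟩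
        γ + ∑[ _ < suc i ] 1
          ≡⟨ cong (γ +_) (trans (∑-const (suc i) 1) (*-identityʳ (suc i))) ⟩
        γ + suc i ∎
        where open ≡-Reasoning
      too-many : suc m ≤ m
      too-many = begin
        suc m                        ≤⟨ m≤m+n (suc m) i ⟩
        suc m + i                    ≡⟨ 1+m+i≡2*[γ+1+i] γ i ⟩
        2 * (γ + suc i)              ≡⟨ cong (2 *_) (sym count≡) ⟩
        2 * Even.positiveElementsUpTo m
          ≤⟨ Even.2*positiveElementsUpTo≤ m (subst (λ x → even x ≡ false) (sym 1+m≡) gap?) ⟩
        m                            ∎
        where
        open ≤-Reasoning
        1+m+i≡2*[γ+1+i] : ∀ γ i → suc (2 * γ + 1 + i) + i ≡ 2 * (γ + suc i)
        1+m+i≡2*[γ+1+i] = solve-∀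

  2γ+1≡1+2γ : 2 * γ + 1 ≡ suc (2 * γ)
  2γ+1≡1+2γ = +-comm (2 * γ) 1

  even-large : ∀ {n} → 2 * γ + 1 ≤ n → even n ≡ true
  even-large {n} 2γ+1≤n = subst (λ x → even x ≡ true) (m+[n∸m]≡n 2γ+1≤n) (evens-from-2γ+1 (suc d) d ≤-refl)
    where d = n ∸ (2 * γ + 1)

  evenGaps≡γ : ∀ {n} → 2 * γ + 1 ≤ n → evenGaps n ≡ γ
  evenGaps≡γ {n} 2γ+1≤n = begin
    evenGaps n
      ≡⟨ ∑-vanishing-tail _ (subst (_≤ n) 2γ+1≡1+2γ 2γ+1≤n)
           (λ i 1+2γ≤i → cong (λ b → ⟦ not b ⟧) (even-large (subst (_≤ i) (sym 2γ+1≡1+2γ) 1+2γ≤i))) ⟩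
    evenGaps (suc (2 * γ))
      ≡⟨ +-cancelʳ-≡ _ _ γ (begin
           evenGaps (suc (2 * γ)) + γ
             ≡⟨ cong (evenGaps (suc (2 * γ)) +_) (sym evenElementsUpTo[2γ]≡γ) ⟩
           evenGaps (suc (2 * γ)) + Even.positiveElementsUpTo (2 * γ)
             ≡⟨ Even.gapsBelow[1+m]+positiveElementsUpTo≡m (2 * γ) ⟩
           2 * γ
             ≡⟨ cong (γ +_) (+-identityʳ γ) ⟩
           γ + γ ∎) ⟩
    γ ∎
    where open ≡-Reasoning

  evenGaps≤γ : ∀ n → evenGaps n ≤ γ
  evenGaps≤γ n = begin
    evenGaps n                    ≤⟨ count-mono _ (m≤m+n n (2 * γ + 1)) ⟩
    evenGaps (n + (2 * γ + 1))    ≡⟨ evenGaps≡γ (m≤n+m _ n) ⟩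
    γ                             ∎
    where open ≤-Reasoning

  evenGap≤2γ : ∀ {e} → even e ≡ false → e ≤ 2 * γ
  evenGap≤2γ {e} ee with 2 * γ + 1 ≤? e
  ... | yes 2γ+1≤e = contradiction (trans (sym (even-large 2γ+1≤e)) ee) λ ()
  ... | no  2γ+1≰e = ≤-pred (subst (e <_) 2γ+1≡1+2γ (≰⇒> 2γ+1≰e))

  oddGaps-small : ∀ {i} → i ≤ 2 * γ + 1 → oddGaps i ≡ i
  oddGaps-small {i} i≤2γ+1 = begin
    oddGaps i
      ≡⟨ ∑-cong i (λ u u<i → cong (λ b → ⟦ not b ⟧) (odd-small (u≤2γ (<-≤-trans u<i i≤2γ+1)))) ⟩
    ∑[ _ < i ] 1      ≡⟨ ∑-const i 1 ⟩
    i * 1             ≡⟨ *-identityʳ i ⟩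
    i                 ∎
    where
    open ≡-Reasoning
    u≤2γ : ∀ {u} → u < 2 * γ + 1 → u ≤ 2 * γ
    u≤2γ {u} u<2γ+1 = ≤-pred (subst (u <_) 2γ+1≡1+2γ u<2γ+1)

  B : ℕ
  B = bound S

  2γ+1≤B : 2 * γ + 1 ≤ B
  2γ+1≤B = begin
    2 * γ + 1          ≤⟨ +-monoˡ-≤ 1 (m≤n*m (2 * γ) 2) ⟩
    2 * (2 * γ) + 1    ≡⟨ +-comm (2 * (2 * γ)) 1 ⟩
    suc (2 * (2 * γ))  <⟨ gap<bound S (odd-small ≤-refl) ⟩
    B                  ∎
    where open ≤-Reasoning

  K : ℕ
  K = oddGaps B

  2γ+1≤K : 2 * γ + 1 ≤ K
  2γ+1≤K = subst (_≤ K) (oddGaps-small ≤-refl) (count-mono _ 2γ+1≤B)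

  1≤K : 1 ≤ K
  1≤K = ≤-trans (m≤n+m 1 (2 * γ)) 2γ+1≤K

  genus≡γ+K : genus S ≡ γ + K
  genus≡γ+K = begin
    genus S          ≡⟨ genus≡gapsBelow-bound S ⟩
    rank B           ≡⟨ sym (∑-vanishing-tail _ (m≤n*m B 2) (λ x B≤x → cong (λ b → ⟦ not b ⟧) (beyond S x B≤x))) ⟩
    rank (2 * B)     ≡⟨ rank-2* B ⟩
    evenGaps B + K   ≡⟨ cong (_+ K) (evenGaps≡γ 2γ+1≤B) ⟩
    γ + K            ∎
    where open ≡-Reasoning

  2*rank[1+x]≤2γ+x+1 : ∀ x → 2 * rank (suc x) ≤ 2 * γ + x + 1
  2*rank[1+x]≤2γ+x+1 x with even-or-odd x
  ... | m , inj₁ refl = begin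
    2 * rank (suc (2 * m))                 ≡⟨ cong (2 *_) (rank-1+2* m) ⟩
    2 * (evenGaps (suc m) + oddGaps m)     ≤⟨ *-monoʳ-≤ 2 (+-mono-≤ (evenGaps≤γ (suc m)) (count≤ _ m)) ⟩
    2 * (γ + m)                            ≤⟨ ≤-reflexive (*-distribˡ-+ 2 γ m) ⟩
    2 * γ + 2 * m                          ≤⟨ m≤m+n _ 1 ⟩
    2 * γ + 2 * m + 1                      ∎
    where open ≤-Reasoning
  ... | m , inj₂ refl = begin
    2 * rank (suc (suc (2 * m)))           ≡⟨ cong (λ y → 2 * rank y) (2+2*m≡2*[1+m] m) ⟩
    2 * rank (2 * suc m)                   ≡⟨ cong (2 *_) (rank-2* (suc m)) ⟩
    2 * (evenGaps (suc m) + oddGaps (suc m)) ≤⟨ *-monoʳ-≤ 2 (+-mono-≤ (evenGaps≤γ (suc m)) (count≤ _ (suc m))) ⟩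
    2 * (γ + suc m)                        ≡⟨ 2*[γ+1+m]≡2γ+[1+2m]+1 γ m ⟩
    2 * γ + suc (2 * m) + 1                ∎
    where
    open ≤-Reasoning
    2+2*m≡2*[1+m] : ∀ m → suc (suc (2 * m)) ≡ 2 * suc m
    2+2*m≡2*[1+m] = solve-∀
    2*[γ+1+m]≡2γ+[1+2m]+1 : ∀ γ m → 2 * (γ + suc m) ≡ 2 * γ + suc (2 * m) + 1
    2*[γ+1+m]≡2γ+[1+2m]+1 = solve-∀

  1⊔[1+rank∸2γ]≤weight : ∀ {x} → mem S x ≡ false → 1 ⊔ (suc (rank x) ∸ 2 * γ) ≤ weight x
  1⊔[1+rank∸2γ]≤weight {x} Sx = ⊔-lub (m<n⇒0<n∸m r<x) (m≤n+o⇒m∸n≤o (suc r) (2 * γ) 1+r≤2γ+w)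
    where
    r = rank x
    w = x ∸ r
    r<x : r < x
    r<x = rank<gap Sx
    1+r≤2γ+w : suc r ≤ 2 * γ + w
    1+r≤2γ+w = +-cancelʳ-≤ (suc r) _ _ (begin
      suc r + suc r                ≡⟨ cong (suc r +_) (sym (+-identityʳ (suc r))) ⟩
      2 * suc r                    ≡⟨ cong (2 *_) (trans (+-comm 1 r) (cong (λ b → r + ⟦ not b ⟧) (sym Sx))) ⟩
      2 * rank (suc x)             ≤⟨ 2*rank[1+x]≤2γ+x+1 x ⟩
      2 * γ + x + 1                ≡⟨ cong (λ y → 2 * γ + y + 1) (sym (m∸n+n≡m (<⇒≤ r<x))) ⟩
      2 * γ + (w + r) + 1          ≡⟨ regroup (2 * γ) w r ⟩
      2 * γ + w + suc r            ∎)
      where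
      open ≤-Reasoning
      regroup : ∀ a w r → a + (w + r) + 1 ≡ a + w + suc r
      regroup = solve-∀

  lower-bound : 2 * γ + 1 ≤ genus S → (genus S ∸ 2 * γ) C 2 + 2 * γ ≤ KWeight S
  lower-bound 2γ+1≤g = begin
    (g ∸ 2 * γ) C 2 + 2 * γ              ≡⟨ cong (λ k → k C 2 + 2 * γ) g∸2γ≡1+t ⟩
    suc t C 2 + 2 * γ                    ≡⟨ +-comm (suc t C 2) (2 * γ) ⟩
    2 * γ + suc t C 2                    ≡⟨ sym (∑-1⊔[1+j∸a] (2 * γ) t) ⟩
    ∑[ j < 2 * γ + t ] v j               ≡⟨ cong (λ k → ∑< k v) (sym g∸1≡2γ+t) ⟩
    ∑[ j < g ∸ 1 ] v j                   ≡⟨ sym (∑-below v (m∸n≤m g 1)) ⟩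
    ∑[ j < g ] (⟦ j <ᵇ g ∸ 1 ⟧ * v j)
      ≡⟨ cong (λ k → ∑[ j < k ] (⟦ j <ᵇ g ∸ 1 ⟧ * v j)) (genus≡gapsBelow-bound S) ⟩
    ∑[ j < rank B ] (⟦ j <ᵇ g ∸ 1 ⟧ * v j)
      ≤⟨ ∑-rank-≥ (λ x → not (mem S x)) B (λ x → ⟦ rank x <ᵇ g ∸ 1 ⟧ * weight x) _
           (λ x _ gap → *-monoʳ-≤ ⟦ rank x <ᵇ g ∸ 1 ⟧ (1⊔[1+rank∸2γ]≤weight (not-injective gap))) ⟩
    ∑[ x < B ] (⟦ not (mem S x) ⟧ * (⟦ rank x <ᵇ g ∸ 1 ⟧ * weight x))
                                         ≡⟨ sym (KWeight≡∑-gaps S) ⟩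
    KWeight S                            ∎
    where
    open ≤-Reasoning
    g = genus S
    t = g ∸ suc (2 * γ)
    v : ℕ → ℕ
    v j = 1 ⊔ (suc j ∸ 2 * γ)
    g≡1+2γ+t : g ≡ suc (2 * γ + t)
    g≡1+2γ+t = sym (m+[n∸m]≡n (subst (_≤ g) 2γ+1≡1+2γ 2γ+1≤g))
    g∸1≡2γ+t : g ∸ 1 ≡ 2 * γ + t
    g∸1≡2γ+t = cong (_∸ 1) g≡1+2γ+t
    g∸2γ≡1+t : g ∸ 2 * γ ≡ suc t
    g∸2γ≡1+t = begin-equality
      g ∸ 2 * γ                ≡⟨ cong (_∸ 2 * γ) (trans g≡1+2γ+t (sym (+-suc (2 * γ) t))) ⟩
      2 * γ + suc t ∸ 2 * γ    ≡⟨ m+n∸m≡n (2 * γ) (suc t) ⟩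
      suc t                    ∎

  evenGapsUpTo : ℕ → ℕ
  evenGapsUpTo = count (λ n → not (even (suc n)))

  evenGapsUpTo≤γ : ∀ m → evenGapsUpTo m ≤ γ
  evenGapsUpTo≤γ m = begin
    evenGapsUpTo m                     ≤⟨ m≤n+m _ _ ⟩
    ⟦ not (even 0) ⟧ + evenGapsUpTo m  ≡⟨ sym (∑-head m (λ e → ⟦ not (even e) ⟧)) ⟩
    evenGaps (suc m)                   ≤⟨ evenGaps≤γ (suc m) ⟩
    γ                                  ∎
    where open ≤-Reasoning

  -- For an odd element 2(μ+n)+1 < 2i+1, the difference 2(δ−n), δ = i−μ, must be an even gap.
  oddElems≤evenGapsUpTo : ∀ {i μ} → odd i ≡ false → μ ≤ i → (∀ u → u < μ → odd u ≡ false) →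
                          oddElems i ≤ evenGapsUpTo (i ∸ μ)
  oddElems≤evenGapsUpTo {i} {μ} oi μ≤i before = begin
    oddElems i                                     ≡⟨ cong oddElems (sym μ+δ≡i) ⟩
    oddElems (μ + δ)                               ≡⟨ ∑-split μ δ _ ⟩
    oddElems μ + ∑[ n < δ ] ⟦ odd (μ + n) ⟧
      ≡⟨ cong (_+ ∑[ n < δ ] ⟦ odd (μ + n) ⟧) (∑-zero μ _ (λ u u<μ → cong ⟦_⟧ (before u u<μ))) ⟩
    ∑[ n < δ ] ⟦ odd (μ + n) ⟧                     ≤⟨ ∑-mono-≤ δ (λ n n<δ → reflected n (<⇒≤ n<δ)) ⟩
    ∑[ n < δ ] ⟦ not (even (δ ∸ n)) ⟧              ≡⟨ ∑-reverse δ _ ⟩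
    ∑[ n < δ ] ⟦ not (even (δ ∸ (δ ∸ suc n))) ⟧
      ≡⟨ ∑-cong δ (λ n n<δ → cong (λ e → ⟦ not (even e) ⟧) (m∸[m∸n]≡n n<δ)) ⟩
    evenGapsUpTo δ                                 ∎
    where
    open ≤-Reasoning
    δ = i ∸ μ
    μ+δ≡i : μ + δ ≡ i
    μ+δ≡i = m+[n∸m]≡n μ≤i
    reflected : ∀ n → n ≤ δ → ⟦ odd (μ + n) ⟧ ≤ ⟦ not (even (δ ∸ n)) ⟧
    reflected n n≤δ with odd (μ + n) in on | even (δ ∸ n) in en
    ... | false | _     = z≤n
    ... | true  | false = ≤-refl
    ... | true  | true  = contradiction (trans (sym odd-i) oi) λ ()
      where
      sum≡i : δ ∸ n + (μ + n) ≡ i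
      sum≡i = begin-equality
        δ ∸ n + (μ + n)   ≡⟨ cong (δ ∸ n +_) (+-comm μ n) ⟩
        δ ∸ n + (n + μ)   ≡⟨ sym (+-assoc (δ ∸ n) n μ) ⟩
        δ ∸ n + n + μ     ≡⟨ cong (_+ μ) (m∸n+n≡m n≤δ) ⟩
        δ + μ             ≡⟨ trans (+-comm δ μ) μ+δ≡i ⟩
        i                 ∎
      odd-i : odd i ≡ true
      odd-i = subst (λ u → odd u ≡ true) sum≡i (even+odd (δ ∸ n) (μ + n) en on)

  oddGapsAbove : ℕ → ℕ
  oddGapsAbove i = ∑[ k < B ] ⟦ not (odd (suc i + k)) ⟧

  oddGaps[1+i]+oddGapsAbove≡K : ∀ i → oddGaps (suc i) + oddGapsAbove i ≡ K
  oddGaps[1+i]+oddGapsAbove≡K i = begin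
    oddGaps (suc i) + oddGapsAbove i  ≡⟨ sym (∑-split (suc i) B _) ⟩
    oddGaps (suc i + B)
      ≡⟨ ∑-vanishing-tail _ (m≤n+m B (suc i)) (λ u B≤u → cong (λ b → ⟦ not b ⟧) (beyond S _ (B≤1+2u B≤u))) ⟩
    K ∎
    where
    open ≡-Reasoning
    B≤1+2u : ∀ {u} → B ≤ u → B ≤ suc (2 * u)
    B≤1+2u {u} B≤u = ≤-trans B≤u (≤-trans (m≤n*m u 2) (n≤1+n _))

  -- Subtracting the least odd element 2μ+1 from an odd gap above 2i+1 leaves an even gap above 2(i−μ).
  oddGapsAbove≤ : ∀ {i μ} → odd μ ≡ true → μ ≤ i →
                  oddGapsAbove i ≤ ∑[ k < B ] ⟦ not (even (suc (i ∸ μ) + k)) ⟧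
  oddGapsAbove≤ {i} {μ} oμ μ≤i = ∑-mono-≤ B shifted
    where
    shifted : ∀ k → k < B → ⟦ not (odd (suc i + k)) ⟧ ≤ ⟦ not (even (suc (i ∸ μ) + k)) ⟧
    shifted k _ with even (suc (i ∸ μ) + k) in ek
    ... | false = ⟦⟧≤1 _
    ... | true  = ≤-reflexive (cong (λ b → ⟦ not b ⟧) odd-above)
      where
      sum≡ : suc (i ∸ μ) + k + μ ≡ suc i + k
      sum≡ = begin-equality
        suc (i ∸ μ) + k + μ   ≡⟨ +-assoc (suc (i ∸ μ)) k μ ⟩
        suc (i ∸ μ) + (k + μ) ≡⟨ cong (suc (i ∸ μ) +_) (+-comm k μ) ⟩
        suc (i ∸ μ) + (μ + k) ≡⟨ sym (+-assoc (suc (i ∸ μ)) μ k) ⟩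
        suc (i ∸ μ + μ) + k   ≡⟨ cong (λ u → suc u + k) (m∸n+n≡m μ≤i) ⟩
        suc i + k             ∎
        where open ≤-Reasoning
      odd-above : odd (suc i + k) ≡ true
      odd-above = subst (λ u → odd u ≡ true) sum≡ (even+odd (suc (i ∸ μ) + k) μ ek oμ)

  oddElems≤γ∸oddGapsAbove : ∀ {i} → odd i ≡ false → oddElems i ≤ γ ∸ (K ∸ 1 ∸ oddGaps i)
  oddElems≤γ∸oddGapsAbove {i} oi with first-true odd i
  ... | inj₁ none = ≤-trans (≤-reflexive (∑-zero i _ (λ u u<i → cong ⟦_⟧ (none u u<i)))) z≤n
  ... | inj₂ (μ , μ<i , oμ , before) = m+n≤o⇒m≤o∸n (oddElems i) (begin
    oddElems i + (K ∸ 1 ∸ oddGaps i)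
      ≡⟨ cong (oddElems i +_) above≡ ⟩
    oddElems i + oddGapsAbove i
      ≤⟨ +-mono-≤ (oddElems≤evenGapsUpTo oi (<⇒≤ μ<i) before) (oddGapsAbove≤ oμ (<⇒≤ μ<i)) ⟩
    evenGapsUpTo δ + ∑[ k < B ] ⟦ not (even (suc (δ + k))) ⟧
      ≡⟨ sym (∑-split δ B _) ⟩
    evenGapsUpTo (δ + B)
      ≤⟨ evenGapsUpTo≤γ (δ + B) ⟩
    γ ∎)
    where
    open ≤-Reasoning
    δ = i ∸ μ
    above≡ : K ∸ 1 ∸ oddGaps i ≡ oddGapsAbove i
    above≡ = begin-equality
      K ∸ 1 ∸ oddGaps i    ≡⟨ ∸-+-assoc K 1 (oddGaps i) ⟩
      K ∸ suc (oddGaps i)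
        ≡⟨ cong (K ∸_) (trans (+-comm 1 (oddGaps i)) (cong (λ b → oddGaps i + ⟦ not b ⟧) (sym oi))) ⟩
      K ∸ oddGaps (suc i)  ≡⟨ cong (_∸ oddGaps (suc i)) (sym (oddGaps[1+i]+oddGapsAbove≡K i)) ⟩
      oddGaps (suc i) + oddGapsAbove i ∸ oddGaps (suc i)
                           ≡⟨ m+n∸m≡n (oddGaps (suc i)) _ ⟩
      oddGapsAbove i ∎

  -- With y odd elements and o odd gaps below 2i+1, we have 2i+1 = o + (1 + o + 2y).
  weight[1+2i]+γ≤ : ∀ i → weight (suc (2 * i)) + γ
                         ≤ suc (oddGaps i) + 2 * oddElems i + (γ ∸ evenGaps (suc i))
  weight[1+2i]+γ≤ i = begin
    weight (suc (2 * i)) + γ  ≡⟨ cong (_+ γ) (cong₂ _∸_ 1+2i≡o+A rank≡o+e) ⟩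
    o + A ∸ (o + e) + γ       ≡⟨ cong (_+ γ) ([m+n]∸[m+o]≡n∸o o A e) ⟩
    A ∸ e + γ                 ≤⟨ m∸n+o≤m+[o∸n] γ e≤A ⟩
    A + (γ ∸ e)               ∎
    where
    open ≤-Reasoning
    o = oddGaps i
    y = oddElems i
    e = evenGaps (suc i)
    A = suc o + 2 * y
    1+2i≡o+A : suc (2 * i) ≡ o + A
    1+2i≡o+A = trans (cong (λ j → suc (2 * j)) (sym (count+count-not odd i))) (regroup y o)
      where
      regroup : ∀ y o → suc (2 * (y + o)) ≡ o + (suc o + 2 * y)
      regroup = solve-∀
    rank≡o+e : rank (suc (2 * i)) ≡ o + e
    rank≡o+e = trans (rank-1+2* i) (+-comm e o)
    e≤A : e ≤ A
    e≤A = +-cancelˡ-≤ o e A (begin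
      o + e                 ≡⟨ sym rank≡o+e ⟩
      rank (suc (2 * i))    ≤⟨ count≤ _ (suc (2 * i)) ⟩
      suc (2 * i)           ≡⟨ 1+2i≡o+A ⟩
      o + A                 ∎)

  γ∸evenGaps[1+i]≡ : ∀ {i} → i < B → γ ∸ evenGaps (suc i) ≡ ∑[ e < B ] (⟦ not (even e) ⟧ * ⟦ i <ᵇ e ⟧)
  γ∸evenGaps[1+i]≡ {i} i<B = begin
    γ ∸ evenGaps (suc i)                         ≡⟨ cong (_∸ evenGaps (suc i)) γ≡ ⟩
    above + evenGaps (suc i) ∸ evenGaps (suc i)  ≡⟨ m+n∸n≡m above (evenGaps (suc i)) ⟩
    above                                        ∎
    where
    open ≡-Reasoning
    above = ∑[ e < B ] (⟦ not (even e) ⟧ * ⟦ i <ᵇ e ⟧)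
    below≡ : ∑[ e < B ] (⟦ e <ᵇ suc i ⟧ * ⟦ not (even e) ⟧) ≡ evenGaps (suc i)
    below≡ = ∑-below (λ e → ⟦ not (even e) ⟧) i<B
    γ≡ : γ ≡ above + evenGaps (suc i)
    γ≡ = begin
      γ                                                    ≡⟨ sym (evenGaps≡γ 2γ+1≤B) ⟩
      evenGaps B                                           ≡⟨ ∑-cong B (λ e _ → split e) ⟩
      ∑[ e < B ] (⟦ not (even e) ⟧ * ⟦ i <ᵇ e ⟧ + ⟦ e <ᵇ suc i ⟧ * ⟦ not (even e) ⟧)
                                                           ≡⟨ ∑-distrib-+ B ⟩
      above + ∑[ e < B ] (⟦ e <ᵇ suc i ⟧ * ⟦ not (even e) ⟧)  ≡⟨ cong (above +_) below≡ ⟩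
      above + evenGaps (suc i)                             ∎
      where
      split : ∀ e → ⟦ not (even e) ⟧ ≡ ⟦ not (even e) ⟧ * ⟦ i <ᵇ e ⟧ + ⟦ e <ᵇ suc i ⟧ * ⟦ not (even e) ⟧
      split e = begin
        ⟦ not (even e) ⟧                                         ≡⟨ sym (*-identityʳ _) ⟩
        ⟦ not (even e) ⟧ * 1
          ≡⟨ cong (⟦ not (even e) ⟧ *_) (sym (⟦m<ᵇn⟧+⟦n<ᵇ1+m⟧≡1 i e)) ⟩
        ⟦ not (even e) ⟧ * (⟦ i <ᵇ e ⟧ + ⟦ e <ᵇ suc i ⟧)        ≡⟨ *-distribˡ-+ ⟦ not (even e) ⟧ _ _ ⟩
        ⟦ not (even e) ⟧ * ⟦ i <ᵇ e ⟧ + ⟦ not (even e) ⟧ * ⟦ e <ᵇ suc i ⟧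
          ≡⟨ cong (⟦ not (even e) ⟧ * ⟦ i <ᵇ e ⟧ +_) (*-comm ⟦ not (even e) ⟧ _) ⟩
        ⟦ not (even e) ⟧ * ⟦ i <ᵇ e ⟧ + ⟦ e <ᵇ suc i ⟧ * ⟦ not (even e) ⟧ ∎

  -- Each even gap 2e is counted once for every i < e, and e ≤ 2·(rank among even gaps) + 1.
  ∑-γ∸evenGaps≤γ*γ : ∑[ i < B ] (γ ∸ evenGaps (suc i)) ≤ γ * γ
  ∑-γ∸evenGaps≤γ*γ = begin
    ∑[ i < B ] (γ ∸ evenGaps (suc i))                               ≡⟨ ∑-cong B (λ i → γ∸evenGaps[1+i]≡) ⟩
    ∑[ i < B ] ∑[ e < B ] (⟦ not (even e) ⟧ * ⟦ i <ᵇ e ⟧)          ≡⟨ ∑-comm B B _ ⟩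
    ∑[ e < B ] ∑[ i < B ] (⟦ not (even e) ⟧ * ⟦ i <ᵇ e ⟧)
      ≡⟨ ∑-cong B (λ e _ → ∑-*ˡ B ⟦ not (even e) ⟧ _) ⟩
    ∑[ e < B ] (⟦ not (even e) ⟧ * count (_<ᵇ e) B)
      ≤⟨ ∑-mono-≤ B (λ e _ → *-monoʳ-≤ ⟦ not (even e) ⟧ (count-<ᵇ≤ B e)) ⟩
    ∑[ e < B ] (⟦ not (even e) ⟧ * e)
      ≤⟨ ∑-rank-≤ (λ e → not (even e)) B (λ e → e) (λ j → 2 * j + 1)
           (λ _ _ → Even.gap≤2*gapsBelow+1 ∘ not-injective) ⟩
    ∑[ j < evenGaps B ] (2 * j + 1)
      ≡⟨ cong (λ n → ∑[ j < n ] (2 * j + 1)) (evenGaps≡γ 2γ+1≤B) ⟩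
    ∑[ j < γ ] (2 * j + 1)                                          ≡⟨ ∑-odd≡square γ ⟩
    γ * γ                                                           ∎
    where open ≤-Reasoning

  -- 2i+1 is an odd gap other than the largest one, ℓ_g, which W_K leaves out.
  selected : ℕ → ℕ
  selected i = ⟦ not (odd i) ⟧ * ⟦ oddGaps i <ᵇ K ∸ 1 ⟧

  selected*m≤m : ∀ i m → selected i * m ≤ m
  selected*m≤m i m = begin
    selected i * m                                      ≡⟨ *-assoc ⟦ not (odd i) ⟧ _ m ⟩
    ⟦ not (odd i) ⟧ * (⟦ oddGaps i <ᵇ K ∸ 1 ⟧ * m)     ≤⟨ ⟦⟧*m≤m (not (odd i)) _ ⟩
    ⟦ oddGaps i <ᵇ K ∸ 1 ⟧ * m                          ≤⟨ ⟦⟧*m≤m (oddGaps i <ᵇ K ∸ 1) m ⟩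
    m                                                   ∎
    where open ≤-Reasoning

  ∑-selected : ∀ (h : ℕ → ℕ) → ∑[ i < B ] (selected i * h (oddGaps i)) ≡ ∑[ j < K ∸ 1 ] h j
  ∑-selected h = begin
    ∑[ i < B ] (selected i * h (oddGaps i))
      ≡⟨ ∑-cong B (λ i _ → *-assoc ⟦ not (odd i) ⟧ _ (h (oddGaps i))) ⟩
    ∑[ i < B ] (⟦ not (odd i) ⟧ * (⟦ oddGaps i <ᵇ K ∸ 1 ⟧ * h (oddGaps i)))
      ≡⟨ ∑-rank (λ i → not (odd i)) B (λ j → ⟦ j <ᵇ K ∸ 1 ⟧ * h j) ⟩
    ∑[ j < K ] (⟦ j <ᵇ K ∸ 1 ⟧ * h j)
      ≡⟨ ∑-below h (m∸n≤m K 1) ⟩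
    ∑[ j < K ∸ 1 ] h j ∎
    where open ≡-Reasoning

  ∑-selected-mono : ∀ {f g : ℕ → ℕ} → (∀ i → odd i ≡ false → f i ≤ g i) →
                    ∑[ i < B ] (selected i * f i) ≤ ∑[ i < B ] (selected i * g i)
  ∑-selected-mono {f} {g} f≤g = ∑-mono-≤ B pointwise
    where
    pointwise : ∀ i → i < B → selected i * f i ≤ selected i * g i
    pointwise i _ with odd i in oi
    ... | true  = z≤n
    ... | false = *-monoʳ-≤ (1 * ⟦ oddGaps i <ᵇ K ∸ 1 ⟧) (f≤g i oi)

  ∑-selected*[1+oddGaps]≡KC2 : ∑[ i < B ] (selected i * suc (oddGaps i)) ≡ K C 2
  ∑-selected*[1+oddGaps]≡KC2 = begin
    ∑[ i < B ] (selected i * suc (oddGaps i))  ≡⟨ ∑-selected suc ⟩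
    ∑[ j < K ∸ 1 ] suc j                       ≡⟨ ∑-suc≡C2 (K ∸ 1) ⟩
    suc (K ∸ 1) C 2                            ≡⟨ cong (_C 2) (trans (+-comm 1 (K ∸ 1)) (m∸n+n≡m 1≤K)) ⟩
    K C 2                                      ∎
    where open ≡-Reasoning

  ∑-selected*2*oddElems≤2*γC2 : ∑[ i < B ] (selected i * (2 * oddElems i)) ≤ 2 * (γ C 2)
  ∑-selected*2*oddElems≤2*γC2 = begin
    ∑[ i < B ] (selected i * (2 * oddElems i))
      ≤⟨ ∑-selected-mono (λ i oi → *-monoʳ-≤ 2 (oddElems≤γ∸oddGapsAbove {i} oi)) ⟩
    ∑[ i < B ] (selected i * (2 * (γ ∸ (K ∸ 1 ∸ oddGaps i))))
      ≡⟨ ∑-selected (λ j → 2 * (γ ∸ (K ∸ 1 ∸ j))) ⟩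
    ∑[ j < K ∸ 1 ] (2 * (γ ∸ (K ∸ 1 ∸ j)))
      ≡⟨ ∑-*ˡ (K ∸ 1) 2 _ ⟩
    2 * ∑[ j < K ∸ 1 ] (γ ∸ (K ∸ 1 ∸ j))
      ≤⟨ *-monoʳ-≤ 2 (∑-γ∸[m∸i]≤γC2 γ (K ∸ 1)) ⟩
    2 * (γ C 2) ∎
    where open ≤-Reasoning

  oddWeight : ℕ
  oddWeight = ∑[ i < B ] (selected i * weight (suc (2 * i)))

  oddWeight+[K∸1]*γ≤ : oddWeight + (K ∸ 1) * γ ≤ K C 2 + 2 * (γ C 2) + γ * γ
  oddWeight+[K∸1]*γ≤ = begin
    oddWeight + (K ∸ 1) * γ
      ≡⟨ cong (oddWeight +_) (sym (trans (∑-selected (λ _ → γ)) (∑-const (K ∸ 1) γ))) ⟩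
    oddWeight + ∑[ i < B ] (selected i * γ)
      ≡⟨ sym (∑-*-distribˡ-+ B selected (λ i → weight (suc (2 * i))) (λ _ → γ)) ⟩
    ∑[ i < B ] (selected i * (weight (suc (2 * i)) + γ))
      ≤⟨ ∑-mono-≤ B (λ i _ → *-monoʳ-≤ (selected i) (weight[1+2i]+γ≤ i)) ⟩
    ∑[ i < B ] (selected i * (suc (oddGaps i) + 2 * oddElems i + (γ ∸ evenGaps (suc i))))
      ≡⟨ ∑-*-distribˡ-+ B selected _ _ ⟩
    ∑[ i < B ] (selected i * (suc (oddGaps i) + 2 * oddElems i)) + ∑[ i < B ] (selected i * (γ ∸ evenGaps (suc i)))
      ≡⟨ cong (_+ ∑[ i < B ] (selected i * (γ ∸ evenGaps (suc i)))) (∑-*-distribˡ-+ B selected _ _) ⟩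
    ∑[ i < B ] (selected i * suc (oddGaps i)) + ∑[ i < B ] (selected i * (2 * oddElems i))
      + ∑[ i < B ] (selected i * (γ ∸ evenGaps (suc i)))
      ≤⟨ +-mono-≤ (+-mono-≤ (≤-reflexive ∑-selected*[1+oddGaps]≡KC2) ∑-selected*2*oddElems≤2*γC2)
                  (≤-trans (∑-mono-≤ B (λ i _ → selected*m≤m i _)) ∑-γ∸evenGaps≤γ*γ) ⟩
    K C 2 + 2 * (γ C 2) + γ * γ ∎
    where open ≤-Reasoning

  contribution : ℕ → ℕ
  contribution x = ⟦ not (mem S x) ⟧ * (⟦ rank x <ᵇ genus S ∸ 1 ⟧ * weight x)

  contribution-beyond : ∀ x → B ≤ x → contribution x ≡ 0
  contribution-beyond x B≤x rewrite beyond S x B≤x = refl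

  KWeight≡even+odd : KWeight S ≡ ∑[ i < B ] contribution (2 * i) + ∑[ i < B ] contribution (suc (2 * i))
  KWeight≡even+odd = begin
    KWeight S                    ≡⟨ KWeight≡∑-gaps S ⟩
    ∑[ x < B ] contribution x
      ≡⟨ sym (∑-vanishing-tail contribution (m≤n*m B 2) contribution-beyond) ⟩
    ∑[ x < 2 * B ] contribution x ≡⟨ ∑-even-odd B contribution ⟩
    ∑[ i < B ] contribution (2 * i) + ∑[ i < B ] contribution (suc (2 * i)) ∎
    where open ≡-Reasoning

  -- An even gap 2i has i ≤ 2γ, so every odd number below it is a gap.
  evenGapWeight≤ : ∀ {i} → even i ≡ false → weight (2 * i) ≤ suc (evenGaps i)
  evenGapWeight≤ {i} ei = m≤n+o⇒m∸n≤o (2 * i) (rank (2 * i)) (begin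
    2 * i                            ≡⟨ cong (i +_) (+-identityʳ i) ⟩
    i + i                            ≤⟨ +-monoʳ-≤ i (Even.gap≤2*gapsBelow+1 ei) ⟩
    i + (2 * e + 1)                  ≡⟨ regroup i e ⟩
    e + i + suc e
      ≡⟨ cong (λ o → e + o + suc e) (sym (oddGaps-small (≤-trans (evenGap≤2γ ei) (m≤m+n _ 1)))) ⟩
    e + oddGaps i + suc e            ≡⟨ cong (_+ suc e) (sym (rank-2* i)) ⟩
    rank (2 * i) + suc e             ∎)
    where
    open ≤-Reasoning
    e = evenGaps i
    regroup : ∀ i e → i + (2 * e + 1) ≡ e + i + suc e
    regroup = solve-∀

  evenContribution≤ : ∑[ i < B ] contribution (2 * i) ≤ suc γ C 2
  evenContribution≤ = begin
    ∑[ i < B ] contribution (2 * i)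
      ≤⟨ ∑-mono-≤ B (λ i _ → *-monoʳ-≤ ⟦ not (even i) ⟧ (⟦⟧*m≤m (rank (2 * i) <ᵇ genus S ∸ 1) _)) ⟩
    ∑[ i < B ] (⟦ not (even i) ⟧ * weight (2 * i))
      ≤⟨ ∑-rank-≤ (λ i → not (even i)) B _ suc (λ i _ gap → evenGapWeight≤ {i} (not-injective gap)) ⟩
    ∑[ j < evenGaps B ] suc j      ≡⟨ cong (λ n → ∑[ j < n ] suc j) (evenGaps≡γ 2γ+1≤B) ⟩
    ∑[ j < γ ] suc j               ≡⟨ ∑-suc≡C2 γ ⟩
    suc γ C 2                      ∎
    where open ≤-Reasoning

  oddGaps<K∸1 : ∀ i → rank (suc (2 * i)) < genus S ∸ 1 → oddGaps i < K ∸ 1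
  oddGaps<K∸1 i r<g∸1 with 2 * γ ≤? i
  ... | yes 2γ≤i = +-cancelˡ-< γ _ _ (begin-strict
    γ + oddGaps i                    ≡⟨ cong (_+ oddGaps i) (sym (evenGaps≡γ (s≤s′ 2γ≤i))) ⟩
    evenGaps (suc i) + oddGaps i     ≡⟨ sym (rank-1+2* i) ⟩
    rank (suc (2 * i))               <⟨ r<g∸1 ⟩
    genus S ∸ 1                      ≡⟨ cong (_∸ 1) genus≡γ+K ⟩
    γ + K ∸ 1                        ≡⟨ +-∸-assoc γ 1≤K ⟩
    γ + (K ∸ 1)                      ∎)
    where
    open ≤-Reasoning
    s≤s′ : 2 * γ ≤ i → 2 * γ + 1 ≤ suc i
    s≤s′ le = subst (_≤ suc i) (sym 2γ+1≡1+2γ) (s≤s le)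
  ... | no 2γ≰i = begin-strict
    oddGaps i                        ≡⟨ oddGaps-small (≤-trans (<⇒≤ i<2γ) (m≤m+n _ 1)) ⟩
    i                                <⟨ m+n≤o⇒m≤o∸n (suc i) (≤-trans (+-monoˡ-≤ 1 i<2γ) 2γ+1≤K) ⟩
    K ∸ 1                            ∎
    where
    open ≤-Reasoning
    i<2γ : i < 2 * γ
    i<2γ = ≰⇒> 2γ≰i

  oddContribution≤ : ∑[ i < B ] contribution (suc (2 * i)) ≤ oddWeight
  oddContribution≤ = ∑-mono-≤ B pointwise
    where
    pointwise : ∀ i → i < B → contribution (suc (2 * i)) ≤ selected i * weight (suc (2 * i))
    pointwise i _ with rank (suc (2 * i)) <ᵇ genus S ∸ 1 in r<g∸1
    ... | false = ≤-trans (≤-reflexive (*-zeroʳ ⟦ not (odd i) ⟧)) z≤n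
    ... | true  rewrite <ᵇ-true (oddGaps<K∸1 i (<ᵇ-true⇒< r<g∸1)) = ≤-reflexive (sym (*-assoc ⟦ not (odd i) ⟧ 1 _))

  upper-bound : KWeight S ≤ (genus S ∸ 2 * γ) C 2 + 2 * γ * γ
  upper-bound = +-cancelʳ-≤ ((K ∸ 1) * γ) _ _ (begin
    KWeight S + (K ∸ 1) * γ
      ≡⟨ cong (_+ (K ∸ 1) * γ) KWeight≡even+odd ⟩
    ∑[ i < B ] contribution (2 * i) + ∑[ i < B ] contribution (suc (2 * i)) + (K ∸ 1) * γ
      ≤⟨ +-monoˡ-≤ ((K ∸ 1) * γ) (+-mono-≤ evenContribution≤ oddContribution≤) ⟩
    suc γ C 2 + oddWeight + (K ∸ 1) * γ
      ≡⟨ +-assoc (suc γ C 2) oddWeight _ ⟩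
    suc γ C 2 + (oddWeight + (K ∸ 1) * γ)
      ≤⟨ +-monoʳ-≤ (suc γ C 2) oddWeight+[K∸1]*γ≤ ⟩
    suc γ C 2 + (K C 2 + 2 * (γ C 2) + γ * γ)
      ≡⟨ cong (λ k → suc γ C 2 + (k C 2 + 2 * (γ C 2) + γ * γ)) K≡1+m ⟩
    suc γ C 2 + (suc m C 2 + 2 * (γ C 2) + γ * γ)
      ≡⟨ C2-identity γ t ⟩
    suc (γ + t) C 2 + 2 * γ * γ + m * γ
      ≡⟨ cong₂ (λ k l → k C 2 + 2 * γ * γ + l * γ) (sym g∸2γ≡1+γ+t) (sym K∸1≡m) ⟩
    (genus S ∸ 2 * γ) C 2 + 2 * γ * γ + (K ∸ 1) * γ ∎)
    where
    open ≤-Reasoning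
    t = K ∸ suc (2 * γ)
    m = 2 * γ + t
    K≡1+m : K ≡ suc m
    K≡1+m = sym (m+[n∸m]≡n (subst (_≤ K) 2γ+1≡1+2γ 2γ+1≤K))
    K∸1≡m : K ∸ 1 ≡ m
    K∸1≡m = cong (_∸ 1) K≡1+m
    g∸2γ≡1+γ+t : genus S ∸ 2 * γ ≡ suc (γ + t)
    g∸2γ≡1+γ+t = begin-equality
      genus S ∸ 2 * γ              ≡⟨ cong (_∸ 2 * γ) (trans genus≡γ+K (cong (γ +_) K≡1+m)) ⟩
      γ + suc (2 * γ + t) ∸ 2 * γ  ≡⟨ cong (_∸ 2 * γ) (regroup γ t) ⟩
      2 * γ + suc (γ + t) ∸ 2 * γ  ≡⟨ m+n∸m≡n (2 * γ) _ ⟩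
      suc (γ + t)                  ∎
      where
      regroup : ∀ γ t → γ + suc (2 * γ + t) ≡ 2 * γ + suc (γ + t)
      regroup = solve-∀

theorem2p1 : (γ : ℕ) (S : NumericalSemigroup) → IsHyperelliptic γ S → 2 * γ + 1 ≤ genus S →
    (((genus S ∸ 2 * γ) C 2) + 2 * γ ≤ KWeight S) × (KWeight S ≤ ((genus S ∸ 2 * γ) C 2) + 2 * γ * γ)
theorem2p1 γ S hyp 2γ+1≤g = lower-bound 2γ+1≤g , upper-bound
  where open Hyperelliptic γ S hyp
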